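{- For each integer $k\ge 1$, the word $w_k=0\,1^4\,0\,1\,1\,(01)^k\,1\,1\,(10)^k$ satisfies $J_{\mathrm{hex}}(w_k)=Z(w_k)/2+1$.
   Context: Words are finite strings over $\{0,1\}$ ($0$ = hydrophobic, $1$ = polar); exponents denote repetition ($1^4=1111$, $(01)^k$ is $01$ repeated $k$ times) and juxtaposition is concatenation. $Z(w)$ is the number of zeros in $w$. The hexagonal lattice is the (3-regular) graph of vertices and edges of the regular hexagonal (honeycomb) tiling of the plane. A fold of a word $w=w_1\cdots w_n$ is a self-avoiding walk $v_1,\dots,v_n$ in this lattice (distinct vertices, $v_i$ adjacent to $v_{i+1}$); its score is the number of pairs $\{i,j\}$ with $|i-j|\ge 2$, $w_i=w_j=0$ and $v_i,v_j$ adjacent. $J_{\mathrm{hex}}(w)$ is the maximum score over all folds of $w$. -}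

module Defs where

open import Data.Bool using (Bool; true; false; _∧_; _∨_; not; T)
open import Data.Bool.Properties using (T?)
open import Data.Nat as ℕ using (ℕ; zero; suc; _+_; _≤_; _<_)
open import Data.Nat.DivMod using (_%_)
open import Data.Integer as ℤ using (ℤ; ∣_∣)
open import Data.Fin using (Fin; toℕ)
open import Data.List using (List; []; _∷_; _++_; length; replicate; concat; filter; allFin; cartesianProduct)
open import Data.Product using (_×_; _,_; proj₁; proj₂; Σ; ∃)
open import Relation.Nullary using (Dec; does)
open import Relation.Binary.PropositionalEquality using (_≡_)
open import Function.Definitions using (Injective)

-- Words over {0,1}; b0 = hydrophobic (0), b1 = polar (1)

data Bit : Set where
  b0 b1 : Bit

Word : Set
Word = List Bit

isZero : Bit → Bool
isZero b0 = true
isZero b1 = false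

Z : Word → ℕ
Z []       = 0
Z (b0 ∷ w) = suc (Z w)
Z (b1 ∷ w) = Z w

pow : ℕ → Word → Word
pow zero    u = []
pow (suc k) u = u ++ pow k u

wk : ℕ → Word
wk k = b0 ∷ (b1 ∷ b1 ∷ b1 ∷ b1 ∷ b0 ∷ b1 ∷ b1 ∷ [])
       ++ pow k (b0 ∷ b1 ∷ [])
       ++ (b1 ∷ b1 ∷ [])
       ++ pow k (b1 ∷ b0 ∷ [])

-- Hexagonal lattice, in the standard "brick wall" coordinates:
-- vertices are ℤ × ℤ; (x,y) is adjacent to (x±1,y), and to (x,y+1)
-- if x+y is even, to (x,y-1) if x+y is odd.  This graph is isomorphic
-- to the honeycomb graph.

Vertex : Set
Vertex = ℤ × ℤ

_==_ : ℤ → ℤ → Bool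
a == b = does (a ℤ.≟ b)

evenℤ : ℤ → Bool
evenℤ z = (∣ z ∣ % 2) ℕ.≡ᵇ 0

adjᵇ : Vertex → Vertex → Bool
adjᵇ (x , y) (x' , y') =
     ((y' == y) ∧ ((x' == (x ℤ.+ ℤ.1ℤ)) ∨ (x' == (x ℤ.- ℤ.1ℤ))))
  ∨ ((x' == x) ∧ ((evenℤ (x ℤ.+ y) ∧ (y' == (y ℤ.+ ℤ.1ℤ)))
                 ∨ (not (evenℤ (x ℤ.+ y)) ∧ (y' == (y ℤ.- ℤ.1ℤ)))))

Adjacent : Vertex → Vertex → Set
Adjacent u v = T (adjᵇ u v)

record Fold (w : Word) : Set where
  field
    pos      : Fin (length w) → Vertex
    selfAvoiding : Injective _≡_ _≡_ pos
    walk     : ∀ (i j : Fin (length w)) → suc (toℕ i) ≡ toℕ j → Adjacent (pos i) (pos j)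
open Fold public

letter : (w : Word) → Fin (length w) → Bit
letter (b ∷ w) Fin.zero    = b
letter (b ∷ w) (Fin.suc i) = letter w i

-- contact predicate on ordered pairs (i,j) with i + 2 ≤ j
-- (counting ordered pairs with i < j counts each unordered pair once)
contactᵇ : (w : Word) → Fold w → Fin (length w) × Fin (length w) → Bool
contactᵇ w f (i , j) =
  ((suc (suc (toℕ i))) ℕ.≤ᵇ toℕ j)
  ∧ isZero (letter w i) ∧ isZero (letter w j)
  ∧ adjᵇ (pos f i) (pos f j)

score : (w : Word) → Fold w → ℕ
score w f = length (filter (λ p → T? (contactᵇ w f p))
                           (cartesianProduct (allFin (length w)) (allFin (length w))))

JhexIs : Word → ℕ → Set
JhexIs w m = (Σ (Fold w) λ f → score w f ≡ m) × (∀ (f : Fold w) → score w f ≤ m)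

-- Upper bound: every site of the honeycomb lattice has three neighbours. In a fold, a residue in the
-- interior of the chain already uses two of them for its chain neighbours, so it is in contact with at
-- most one other residue, and an end residue with at most two. Summing over the hydrophobic residues
-- counts every contact twice, hence 2 · score ≤ Z(w) + 2 for every word w and every fold; for w_k,
-- where Z(w_k) = 2k + 2, this is score ≤ k + 2 = Z(w_k)/2 + 1.
--
-- Lower bound: fold the prefix 0 1^4 0 1 1 around a hexagon and let the arms (01)^k 1 and 1 (10)^k
-- run along two adjacent rows. The k hydrophobic residues of the first arm face hydrophobic residues
-- of the second arm, and the first residue touches both the sixth and the last one: k + 2 contacts.

module Submission where

open import Defs
open import Data.Nat using (ℕ; _≤_; _+_)
open import Data.Nat.DivMod using (_/_)

open import Data.Bool using (Bool; true; false; not; _∧_; _∨_; T; if_then_else_)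
open import Data.Bool.Properties using (T-∧; T-∨; T-≡; T-not-≡; not-involutive)
open import Data.Empty using (⊥; ⊥-elim)
open import Data.Fin using (Fin; zero; suc; toℕ; punchOut)
open import Data.Fin.Patterns using (0F; 1F; 2F)
open import Data.Fin.Properties using (toℕ<n; toℕ-injective; ¬Fin0; 0≢1+n; punchOut-injective; suc-injective)
open import Data.Integer as ℤ using (ℤ; 1ℤ)
import Data.Integer.Properties as ℤP
open import Data.Integer.Tactic.RingSolver as ℤ-Solver using ()
open import Data.List using ([]; _∷_; _++_; length; map; filter; tabulate; cartesianProduct)
open import Data.List.Properties using (filter-++; length-++; map-tabulate)
open import Data.Nat using (zero; suc; pred; _*_; _∸_; _<_; z≤n; s≤s; s≤s⁻¹; _%_; _≡ᵇ_; _<ᵇ_; _≤ᵇ_)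
open import Data.Nat.DivMod using (m*n/n≡m)
open import Data.Nat.Properties
  using ( ≤-refl; ≤-trans; ≤-reflexive; ≤-antisym; _≤?_; <-cmp; <⇒≤; <⇒≱; ≰⇒>; <-trans; n<1+n; n≤1+n; 1+n≰n
        ; n≤0⇒n≡0; ≤ᵇ⇒≤; ≤⇒≤ᵇ; ≡ᵇ⇒≡; <⇒<ᵇ; m≤n⇒∃[o]m+o≡n
        ; +-comm; +-assoc; +-suc; +-identityʳ; m≤m+n; m≤n+m; m<m+n
        ; +-mono-≤; +-monoˡ-≤; +-monoʳ-≤; +-monoʳ-<; +-cancelˡ-≤; +-cancelˡ-<; *-monoˡ-≤; *-monoˡ-<; *-cancelˡ-≤
        ; m∸[m∸n]≡n; m+n∸m≡n; +-∸-assoc; module ≤-Reasoning; +-0-commutativeMonoid )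
open import Data.Nat.Tactic.RingSolver as ℕ-Solver using ()
open import Algebra.Properties.CommutativeMonoid.Sum +-0-commutativeMonoid
  using (sum-syntax; sum-cong-≗; ∑-comm; ∑-distrib-+; sum-replicate-zero)
open import Data.Product using (_×_; _,_; proj₁; proj₂; ∃)
open import Data.Sum using (_⊎_; inj₁; inj₂; [_,_]′)
open import Data.Unit using (tt)
open import Function using (_∘_; Equivalence)
open import Function.Definitions using (Injective)
open import Relation.Binary.Definitions using (tri<; tri≈; tri>)
open import Relation.Binary.PropositionalEquality
open import Relation.Nullary using (¬_; yes; no; contradiction)
open import Relation.Nullary.Decidable using (T?)
open Equivalence using (to; from)

-- Counting

⟦_⟧ : Bool → ℕ
⟦ false ⟧ = 0
⟦ true  ⟧ = 1

⟦⟧≤1 : ∀ b → ⟦ b ⟧ ≤ 1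
⟦⟧≤1 false = z≤n
⟦⟧≤1 true  = ≤-refl

⟦⟧-true : ∀ {b} → T b → ⟦ b ⟧ ≡ 1
⟦⟧-true {true} _ = refl

⟦⟧-mono : ∀ {a b} → (T a → T b) → ⟦ a ⟧ ≤ ⟦ b ⟧
⟦⟧-mono {false}        _   = z≤n
⟦⟧-mono {true} {true}  _   = ≤-refl
⟦⟧-mono {true} {false} a⇒b = ⊥-elim (a⇒b tt)

⟦⟧-∨ : ∀ {a b} → (T a → T b → ⊥) → ⟦ a ⟧ + ⟦ b ⟧ ≡ ⟦ a ∨ b ⟧
⟦⟧-∨ {false}        _        = refl
⟦⟧-∨ {true} {false} _        = refl
⟦⟧-∨ {true} {true}  disjoint = ⊥-elim (disjoint tt tt)

≤-⟦⟧+ : ∀ b {x y} → (¬ T b → x ≡ 0) → x ≤ 1 + y → x ≤ ⟦ b ⟧ + y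
≤-⟦⟧+ true  _     x≤1+y = x≤1+y
≤-⟦⟧+ false x≡0   _     = ≤-trans (≤-reflexive (x≡0 (λ ()))) z≤n

⟦<ᵇ⟧+⟦≡ᵇ⟧ : ∀ {c m} → c ≤ m → ⟦ c <ᵇ m ⟧ + ⟦ c ≡ᵇ m ⟧ ≡ 1
⟦<ᵇ⟧+⟦≡ᵇ⟧ {m = zero}  z≤n       = refl
⟦<ᵇ⟧+⟦≡ᵇ⟧ {m = suc m} z≤n       = refl
⟦<ᵇ⟧+⟦≡ᵇ⟧             (s≤s c≤m) = ⟦<ᵇ⟧+⟦≡ᵇ⟧ c≤m

∑-mono-≤ : ∀ {n} {f g : Fin n → ℕ} → (∀ i → f i ≤ g i) → ∑[ i < n ] f i ≤ ∑[ i < n ] g i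
∑-mono-≤ {zero}  _   = z≤n
∑-mono-≤ {suc n} f≤g = +-mono-≤ (f≤g zero) (∑-mono-≤ (f≤g ∘ suc))

count : ∀ {n} → (Fin n → Bool) → ℕ
count {n} P = ∑[ i < n ] ⟦ P i ⟧

count-none : ∀ {n} (P : Fin n → Bool) → (∀ i → ¬ T (P i)) → count P ≡ 0
count-none {n} P none = n≤0⇒n≡0 (begin
  count P             ≤⟨ ∑-mono-≤ (λ i → ⟦⟧-mono {b = false} (none i)) ⟩
  ∑[ i < n ] 0        ≡⟨ sum-replicate-zero n ⟩
  0                   ∎)
  where open ≤-Reasoning

count-≤-injection : ∀ {n m} (P : Fin n → Bool) (g : ∀ i → T (P i) → Fin m) →
                    (∀ {i j} (p : T (P i)) (q : T (P j)) → g i p ≡ g j q → i ≡ j) →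
                    count P ≤ m
count-≤-injection {n} {zero} P g _ = ≤-reflexive (count-none P (λ i → ¬Fin0 ∘ g i))
count-≤-injection {zero} {suc m} _ _ _ = z≤n
count-≤-injection {suc n} {suc m} P g g-inj with P zero in P₀
... | false = count-≤-injection (P ∘ suc) (g ∘ suc) (λ p q → suc-injective ∘ g-inj p q)
... | true  = s≤s (count-≤-injection (P ∘ suc) (λ i p → punchOut (g₀≢ i p))
                    (λ p q → suc-injective ∘ g-inj p q ∘ punchOut-injective (g₀≢ _ p) (g₀≢ _ q)))
  where
  p₀ : T (P zero)
  p₀ = from T-≡ P₀
  g₀≢ : ∀ i (p : T (P (suc i))) → g zero p₀ ≢ g (suc i) p
  g₀≢ i p = 0≢1+n ∘ g-inj p₀ p

count-≡ᵇ : ∀ n c → count {n} (λ b → toℕ b ≡ᵇ c) ≡ ⟦ c <ᵇ n ⟧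
count-≡ᵇ zero    c       = refl
count-≡ᵇ (suc n) zero    = cong suc (sum-replicate-zero n)
count-≡ᵇ (suc n) (suc c) = count-≡ᵇ n c

count-predecessors : ∀ n c → c < n → count {n} (λ b → suc (toℕ b) ≡ᵇ c) + ⟦ c ≡ᵇ 0 ⟧ ≡ 1
count-predecessors n zero    _     = cong (_+ 1) (sum-replicate-zero n)
count-predecessors n (suc c) c+1<n = begin
  count {n} (λ b → toℕ b ≡ᵇ c) + 0  ≡⟨ +-identityʳ _ ⟩
  count {n} (λ b → toℕ b ≡ᵇ c)      ≡⟨ count-≡ᵇ n c ⟩
  ⟦ c <ᵇ n ⟧                        ≡⟨ ⟦⟧-true (<⇒<ᵇ (≤-trans (n≤1+n _) c+1<n)) ⟩
  1                                 ∎
  where open ≡-Reasoning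

count-successors : ∀ n c → c < n → count {n} (λ b → toℕ b ≡ᵇ suc c) + ⟦ c ≡ᵇ pred n ⟧ ≡ 1
count-successors (suc n) c c<n =
  trans (cong (_+ ⟦ c ≡ᵇ n ⟧) (count-≡ᵇ (suc n) (suc c))) (⟦<ᵇ⟧+⟦≡ᵇ⟧ (s≤s⁻¹ c<n))

length-filter-tabulate : ∀ {A : Set} {n} (P : A → Bool) (f : Fin n → A) →
                         length (filter (T? ∘ P) (tabulate f)) ≡ ∑[ i < n ] ⟦ P (f i) ⟧
length-filter-tabulate {n = zero}  P f = refl
length-filter-tabulate {n = suc n} P f with P (f zero)
... | true  = cong suc (length-filter-tabulate P (f ∘ suc))
... | false = length-filter-tabulate P (f ∘ suc)

length-filter-cartesianProduct :
  ∀ {A B : Set} {m n} (P : A × B → Bool) (f : Fin m → A) (g : Fin n → B) →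
  length (filter (T? ∘ P) (cartesianProduct (tabulate f) (tabulate g)))
    ≡ ∑[ i < m ] ∑[ j < n ] ⟦ P (f i , g j) ⟧
length-filter-cartesianProduct {m = zero}  P f g = refl
length-filter-cartesianProduct {m = suc m} P f g = begin
  length (filter P? (row ++ rest))                   ≡⟨ cong length (filter-++ P? row rest) ⟩
  length (filter P? row ++ filter P? rest)           ≡⟨ length-++ (filter P? row) ⟩
  length (filter P? row) + length (filter P? rest)
    ≡⟨ cong₂ _+_ (trans (cong (length ∘ filter P?) (map-tabulate g (f zero ,_)))
                        (length-filter-tabulate P (λ j → f zero , g j)))
                 (length-filter-cartesianProduct P (f ∘ suc) g) ⟩
  ∑[ j < _ ] ⟦ P (f zero , g j) ⟧ + ∑[ i < m ] ∑[ j < _ ] ⟦ P (f (suc i) , g j) ⟧ ∎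
  where
  open ≡-Reasoning
  P? = T? ∘ P
  row = map (f zero ,_) (tabulate g)
  rest = cartesianProduct (tabulate (f ∘ suc)) (tabulate g)

sumBelow : ℕ → (ℕ → ℕ) → ℕ
sumBelow zero    h = 0
sumBelow (suc n) h = h 0 + sumBelow n (h ∘ suc)

∑-toℕ : ∀ n h → ∑[ i < n ] h (toℕ i) ≡ sumBelow n h
∑-toℕ zero    h = refl
∑-toℕ (suc n) h = cong (h 0 +_) (∑-toℕ n (h ∘ suc))

sumBelow-+ : ∀ m n h → sumBelow (m + n) h ≡ sumBelow m h + sumBelow n (λ j → h (m + j))
sumBelow-+ zero    n h = refl
sumBelow-+ (suc m) n h = trans (cong (h 0 +_) (sumBelow-+ m n (h ∘ suc))) (sym (+-assoc (h 0) _ _))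

term≤sumBelow : ∀ {m n} h → m < n → h m ≤ sumBelow n h
term≤sumBelow {zero}  {suc n} h _         = m≤m+n (h 0) _
term≤sumBelow {suc m} {suc n} h (s≤s m<n) = ≤-trans (term≤sumBelow (h ∘ suc) m<n) (m≤n+m _ (h 0))

two-terms≤sumBelow : ∀ {m m′ n} h → m < m′ → m′ < n → h m + h m′ ≤ sumBelow n h
two-terms≤sumBelow {zero}  {suc m′} {suc n} h _          (s≤s m′<n) =
  +-monoʳ-≤ (h 0) (term≤sumBelow (h ∘ suc) m′<n)
two-terms≤sumBelow {suc m} {suc m′} {suc n} h (s≤s m<m′) (s≤s m′<n) =
  ≤-trans (two-terms≤sumBelow (h ∘ suc) m<m′ m′<n) (m≤n+m _ (h 0))

sumBelow-*2≤ : ∀ k h → sumBelow k (λ t → h (t * 2)) ≤ sumBelow (k * 2) h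
sumBelow-*2≤ zero    h = z≤n
sumBelow-*2≤ (suc k) h =
  +-monoʳ-≤ (h 0) (≤-trans (sumBelow-*2≤ k (λ j → h (2 + j))) (m≤n+m _ (h 1)))

k≤sumBelow : ∀ k h → (∀ t → t < k → 1 ≤ h t) → k ≤ sumBelow k h
k≤sumBelow zero    h _        = z≤n
k≤sumBelow (suc k) h positive =
  +-mono-≤ (positive 0 (s≤s z≤n))
           (k≤sumBelow k (h ∘ suc) (λ t t<k → positive (suc t) (s≤s t<k)))

-- Positions past the end read as polar, so they never take part in a contact.
letterAt : Word → ℕ → Bit
letterAt []      _       = b1
letterAt (b ∷ w) zero    = b
letterAt (b ∷ w) (suc m) = letterAt w m

letter≡letterAt : ∀ w i → letter w i ≡ letterAt w (toℕ i)
letter≡letterAt (b ∷ w) zero    = refl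
letter≡letterAt (b ∷ w) (suc i) = letter≡letterAt w i

letterAt-++ˡ : ∀ xs {ys m} → m < length xs → letterAt (xs ++ ys) m ≡ letterAt xs m
letterAt-++ˡ (x ∷ xs) {m = zero}  _         = refl
letterAt-++ˡ (x ∷ xs) {m = suc m} (s≤s m<n) = letterAt-++ˡ xs m<n

letterAt-++ʳ : ∀ xs {ys} m → letterAt (xs ++ ys) (length xs + m) ≡ letterAt ys m
letterAt-++ʳ []       m = refl
letterAt-++ʳ (x ∷ xs) m = letterAt-++ʳ xs m

letterAt-pow-even : ∀ a b {k t} → t < k → letterAt (pow k (a ∷ b ∷ [])) (t * 2) ≡ a
letterAt-pow-even a b {suc k} {zero}  _         = refl
letterAt-pow-even a b {suc k} {suc t} (s≤s t<k) = letterAt-pow-even a b t<k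

letterAt-pow-odd : ∀ a b {k t} → t < k → letterAt (pow k (a ∷ b ∷ [])) (suc (t * 2)) ≡ b
letterAt-pow-odd a b {suc k} {zero}  _         = refl
letterAt-pow-odd a b {suc k} {suc t} (s≤s t<k) = letterAt-pow-odd a b t<k

length-pow : ∀ k u → length (pow k u) ≡ k * length u
length-pow zero    u = refl
length-pow (suc k) u = trans (length-++ u) (cong (length u +_) (length-pow k u))

Z-++ : ∀ xs ys → Z (xs ++ ys) ≡ Z xs + Z ys
Z-++ []        ys = refl
Z-++ (b0 ∷ xs) ys = cong suc (Z-++ xs ys)
Z-++ (b1 ∷ xs) ys = Z-++ xs ys

Z-pow : ∀ k u → Z (pow k u) ≡ k * Z u
Z-pow zero    u = refl
Z-pow (suc k) u = trans (Z-++ u (pow k u)) (cong (Z u +_) (Z-pow k u))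

count-zeros : ∀ w → count (λ i → isZero (letter w i)) ≡ Z w
count-zeros []       = refl
count-zeros (b0 ∷ w) = cong suc (count-zeros w)
count-zeros (b1 ∷ w) = count-zeros w

-- The honeycomb lattice

even-suc : ∀ n → ((suc n % 2) ≡ᵇ 0) ≡ not ((n % 2) ≡ᵇ 0)
even-suc zero          = refl
even-suc (suc zero)    = refl
even-suc (suc (suc n)) = even-suc n

evenℤ-suc : ∀ z → evenℤ (z ℤ.+ 1ℤ) ≡ not (evenℤ z)
evenℤ-suc (ℤ.+ n)        = trans (cong (λ m → (m % 2) ≡ᵇ 0) (+-comm n 1)) (even-suc n)
evenℤ-suc ℤ.-[1+ zero ]  = refl
evenℤ-suc ℤ.-[1+ suc n ] = even-suc n

z-1+1≡z : ∀ z → z ℤ.- 1ℤ ℤ.+ 1ℤ ≡ z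
z-1+1≡z = ℤ-Solver.solve-∀

z+1-1≡z : ∀ z → z ℤ.+ 1ℤ ℤ.- 1ℤ ≡ z
z+1-1≡z = ℤ-Solver.solve-∀

evenℤ-pred : ∀ z → evenℤ (z ℤ.- 1ℤ) ≡ not (evenℤ z)
evenℤ-pred z = begin
  evenℤ (z ℤ.- 1ℤ)                    ≡⟨ not-involutive _ ⟨
  not (not (evenℤ (z ℤ.- 1ℤ)))        ≡⟨ cong not (evenℤ-suc (z ℤ.- 1ℤ)) ⟨
  not (evenℤ (z ℤ.- 1ℤ ℤ.+ 1ℤ))       ≡⟨ cong (not ∘ evenℤ) (z-1+1≡z z) ⟩
  not (evenℤ z)                       ∎
  where open ≡-Reasoning

evenℤ-vertical-suc : ∀ x y → evenℤ (x ℤ.+ (y ℤ.+ 1ℤ)) ≡ not (evenℤ (x ℤ.+ y))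
evenℤ-vertical-suc x y = trans (cong evenℤ (sym (ℤP.+-assoc x y 1ℤ))) (evenℤ-suc (x ℤ.+ y))

evenℤ-vertical-pred : ∀ x y → evenℤ (x ℤ.+ (y ℤ.- 1ℤ)) ≡ not (evenℤ (x ℤ.+ y))
evenℤ-vertical-pred x y =
  trans (cong evenℤ (sym (ℤP.+-assoc x y (ℤ.- 1ℤ)))) (evenℤ-pred (x ℤ.+ y))

evenℤ-*2+0 : ∀ t → T (evenℤ (ℤ.+ (t * 2) ℤ.+ ℤ.+ 0))
evenℤ-*2+0 t = subst (λ m → T ((m % 2) ≡ᵇ 0)) (sym (+-identityʳ (t * 2))) (even t)
  where
  even : ∀ t → T (((t * 2) % 2) ≡ᵇ 0)
  even zero    = tt
  even (suc t) = even t

data Edge : Vertex → Vertex → Set where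
  right : ∀ {x y} → Edge (x , y) (x ℤ.+ 1ℤ , y)
  left  : ∀ {x y} → Edge (x , y) (x ℤ.- 1ℤ , y)
  up    : ∀ {x y} → T (evenℤ (x ℤ.+ y)) → Edge (x , y) (x , y ℤ.+ 1ℤ)
  down  : ∀ {x y} → T (not (evenℤ (x ℤ.+ y))) → Edge (x , y) (x , y ℤ.- 1ℤ)

==⇒≡ : ∀ a b → T (a == b) → a ≡ b
==⇒≡ a b _ with a ℤ.≟ b
==⇒≡ a b _ | yes a≡b = a≡b

≡⇒== : ∀ a → T (a == a)
≡⇒== a with a ℤ.≟ a
... | yes _   = tt
... | no a≢a = a≢a refl

module AdjacencyTests (x y x′ y′ : ℤ) where
  sameRow  = y′ == y
  toRight  = x′ == (x ℤ.+ 1ℤ)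
  toLeft   = x′ == (x ℤ.- 1ℤ)
  sameCol  = x′ == x
  pointsUp = evenℤ (x ℤ.+ y)
  toUp     = y′ == (y ℤ.+ 1ℤ)
  toDown   = y′ == (y ℤ.- 1ℤ)
  horizontal = sameRow ∧ (toRight ∨ toLeft)
  vertical   = sameCol ∧ ((pointsUp ∧ toUp) ∨ (not pointsUp ∧ toDown))

  edge : Adjacent (x , y) (x′ , y′) → Edge (x , y) (x′ , y′)
  edge adj = [ horizontalEdge , verticalEdge ]′ (to (T-∨ {horizontal}) adj)
    where
    horizontalEdge : T horizontal → Edge (x , y) (x′ , y′)
    horizontalEdge h with to (T-∧ {sameRow}) h
    ... | row , step with ==⇒≡ y′ y row | to (T-∨ {toRight}) step
    ...   | refl | inj₁ r rewrite ==⇒≡ x′ (x ℤ.+ 1ℤ) r = right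
    ...   | refl | inj₂ l rewrite ==⇒≡ x′ (x ℤ.- 1ℤ) l = left
    verticalEdge : T vertical → Edge (x , y) (x′ , y′)
    verticalEdge v with to (T-∧ {sameCol}) v
    ... | col , step with ==⇒≡ x′ x col | to (T-∨ {pointsUp ∧ toUp}) step
    ...   | refl | inj₁ u with to (T-∧ {pointsUp}) u
    ...     | even , above rewrite ==⇒≡ y′ (y ℤ.+ 1ℤ) above = up even
    verticalEdge v | col , step | refl | inj₂ d with to (T-∧ {not pointsUp}) d
    ...     | odd , below rewrite ==⇒≡ y′ (y ℤ.- 1ℤ) below = down odd

  adjacent : Edge (x , y) (x′ , y′) → Adjacent (x , y) (x′ , y′)
  adjacent right = from (T-∨ {horizontal}) (inj₁ (from (T-∧ {sameRow})
    (≡⇒== y , from (T-∨ {toRight}) (inj₁ (≡⇒== x′)))))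
  adjacent left = from (T-∨ {horizontal}) (inj₁ (from (T-∧ {sameRow})
    (≡⇒== y , from (T-∨ {toRight}) (inj₂ (≡⇒== x′)))))
  adjacent (up even) = from (T-∨ {horizontal}) (inj₂ (from (T-∧ {sameCol})
    (≡⇒== x , from (T-∨ {pointsUp ∧ toUp}) (inj₁ (from (T-∧ {pointsUp}) (even , ≡⇒== y′))))))
  adjacent (down odd) = from (T-∨ {horizontal}) (inj₂ (from (T-∧ {sameCol})
    (≡⇒== x , from (T-∨ {pointsUp ∧ toUp}) (inj₂ (from (T-∧ {not pointsUp}) (odd , ≡⇒== y′))))))

adjacent⇒edge : ∀ u v → Adjacent u v → Edge u v
adjacent⇒edge (x , y) (x′ , y′) = AdjacencyTests.edge x y x′ y′

edge⇒adjacent : ∀ {u v} → Edge u v → Adjacent u v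
edge⇒adjacent {x , y} {x′ , y′} = AdjacencyTests.adjacent x y x′ y′

edge-sym : ∀ {u v} → Edge u v → Edge v u
edge-sym {x , y} right = subst (λ x′ → Edge (x ℤ.+ 1ℤ , y) (x′ , y)) (z+1-1≡z x) left
edge-sym {x , y} left  = subst (λ x′ → Edge (x ℤ.- 1ℤ , y) (x′ , y)) (z-1+1≡z x) right
edge-sym {x , y} (up even) = subst (λ y′ → Edge (x , y ℤ.+ 1ℤ) (x , y′)) (z+1-1≡z y)
  (down (subst (T ∘ not) (sym (evenℤ-vertical-suc x y)) (subst T (sym (not-involutive _)) even)))
edge-sym {x , y} (down odd) = subst (λ y′ → Edge (x , y ℤ.- 1ℤ) (x , y′)) (z-1+1≡z y)
  (up (subst T (sym (evenℤ-vertical-pred x y)) odd))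

adjacent-sym : ∀ u v → Adjacent u v → Adjacent v u
adjacent-sym u v = edge⇒adjacent ∘ edge-sym ∘ adjacent⇒edge u v

neighbour : Vertex → Fin 3 → Vertex
neighbour (x , y) 0F = (x ℤ.+ 1ℤ , y)
neighbour (x , y) 1F = (x ℤ.- 1ℤ , y)
neighbour (x , y) 2F = (x , (if evenℤ (x ℤ.+ y) then y ℤ.+ 1ℤ else y ℤ.- 1ℤ))

edge-neighbour : ∀ {u v} → Edge u v → ∃ λ d → v ≡ neighbour u d
edge-neighbour right = 0F , refl
edge-neighbour left  = 1F , refl
edge-neighbour {x , y} (up even) =
  2F , cong (λ b → x , (if b then y ℤ.+ 1ℤ else y ℤ.- 1ℤ)) (sym (to T-≡ even))
edge-neighbour {x , y} (down odd) =
  2F , cong (λ b → x , (if b then y ℤ.+ 1ℤ else y ℤ.- 1ℤ)) (sym (to T-not-≡ odd))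

neighbours≤3 : ∀ {n} (p : Fin n → Vertex) → Injective _≡_ _≡_ p →
               ∀ v → count (λ b → adjᵇ v (p b)) ≤ 3
neighbours≤3 p p-injective v = count-≤-injection _ direction direction-injective
  where
  direction : ∀ b → Adjacent v (p b) → Fin 3
  direction b = proj₁ ∘ edge-neighbour ∘ adjacent⇒edge v (p b)
  direction-injective : ∀ {b b′} adj adj′ → direction b adj ≡ direction b′ adj′ → b ≡ b′
  direction-injective {b} {b′} adj adj′ same = p-injective (begin
    p b                              ≡⟨ proj₂ (edge-neighbour (adjacent⇒edge v (p b) adj)) ⟩
    neighbour v (direction b adj)    ≡⟨ cong (neighbour v) same ⟩
    neighbour v (direction b′ adj′)  ≡⟨ proj₂ (edge-neighbour (adjacent⇒edge v (p b′) adj′)) ⟨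
    p b′                             ∎)
    where open ≡-Reasoning

-- The upper bound

score≡∑∑ : ∀ {w} (f : Fold w) →
           score w f ≡ ∑[ i < length w ] ∑[ j < length w ] ⟦ contactᵇ w f (i , j) ⟧
score≡∑∑ f = length-filter-cartesianProduct (contactᵇ _ f) (λ i → i) (λ j → j)

consecutive-not-far : ∀ {i j} → suc j ≡ i ⊎ j ≡ suc i → ¬ (2 + i ≤ j ⊎ 2 + j ≤ i)
consecutive-not-far (inj₁ refl) (inj₁ far) = 1+n≰n (≤-trans (m≤n+m _ 2) far)
consecutive-not-far (inj₁ refl) (inj₂ far) = 1+n≰n (s≤s⁻¹ far)
consecutive-not-far (inj₂ refl) (inj₁ far) = 1+n≰n (s≤s⁻¹ far)
consecutive-not-far (inj₂ refl) (inj₂ far) = 1+n≰n (≤-trans (m≤n+m _ 2) far)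

module _ {w : Word} (f : Fold w) where
  private
    n = length w
    p = pos f

  contact⇒ : ∀ i j → T (contactᵇ w f (i , j)) →
             2 + toℕ i ≤ toℕ j × T (isZero (letter w i)) × T (isZero (letter w j)) × Adjacent (p i) (p j)
  contact⇒ i j c with to (T-∧ {suc (suc (toℕ i)) ≤ᵇ toℕ j}) c
  ... | far , c′ with to (T-∧ {isZero (letter w i)}) c′
  ... | zeroᵢ , c″ with to (T-∧ {isZero (letter w j)}) c″
  ... | zeroⱼ , adj = ≤ᵇ⇒≤ _ _ far , zeroᵢ , zeroⱼ , adj

  contact-asym : ∀ a b → T (contactᵇ w f (a , b)) → ¬ T (contactᵇ w f (b , a))
  contact-asym a b ab ba = 1+n≰n (begin
    suc (toℕ a)  ≤⟨ n≤1+n _ ⟩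
    2 + toℕ a    ≤⟨ proj₁ (contact⇒ a b ab) ⟩
    toℕ b        ≤⟨ m≤n+m _ 2 ⟩
    2 + toℕ b    ≤⟨ proj₁ (contact⇒ b a ba) ⟩
    toℕ a        ∎)
    where open ≤-Reasoning

  touches : Fin n → Fin n → Bool
  touches a b = contactᵇ w f (a , b) ∨ contactᵇ w f (b , a)

  ∑-count-touches≡2*score : ∑[ a < n ] count (touches a) ≡ 2 * score w f
  ∑-count-touches≡2*score = begin
    ∑[ a < n ] ∑[ b < n ] ⟦ touches a b ⟧          ≡⟨ sum-cong-≗ (λ a → sum-cong-≗ (λ b →
                                                        ⟦⟧-∨ {contactᵇ w f (a , b)} (contact-asym a b))) ⟨
    ∑[ a < n ] ∑[ b < n ] (C a b + C b a)           ≡⟨ sum-cong-≗ (λ a → ∑-distrib-+ (C a) (λ b → C b a)) ⟩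
    ∑[ a < n ] (outgoing a + incoming a)            ≡⟨ ∑-distrib-+ outgoing incoming ⟩
    ∑[ a < n ] outgoing a + ∑[ a < n ] incoming a   ≡⟨ cong₂ _+_ refl (∑-comm (λ a b → C b a)) ⟩
    ∑[ a < n ] outgoing a + ∑[ a < n ] outgoing a   ≡⟨ cong₂ _+_ (score≡∑∑ f)
                                                                (trans (+-identityʳ _) (score≡∑∑ f)) ⟨
    2 * score w f                                   ∎
    where
    open ≡-Reasoning
    C : Fin n → Fin n → ℕ
    C a b = ⟦ contactᵇ w f (a , b) ⟧
    outgoing incoming : Fin n → ℕ
    outgoing a = ∑[ b < n ] C a b
    incoming a = ∑[ b < n ] C b a

  touches⇒ : ∀ a b → T (touches a b) →
             T (isZero (letter w a)) × Adjacent (p a) (p b) × (2 + toℕ a ≤ toℕ b ⊎ 2 + toℕ b ≤ toℕ a)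
  touches⇒ a b t with to (T-∨ {contactᵇ w f (a , b)}) t
  ... | inj₁ ab = let far , zeroₐ , _ , adj = contact⇒ a b ab in zeroₐ , adj , inj₁ far
  ... | inj₂ ba = let far , _ , zeroₐ , adj = contact⇒ b a ba in
                  zeroₐ , adjacent-sym (p b) (p a) adj , inj₂ far

  isPredecessor isSuccessor : Fin n → Fin n → Bool
  isPredecessor a b = suc (toℕ b) ≡ᵇ toℕ a
  isSuccessor   a b = toℕ b ≡ᵇ suc (toℕ a)

  touches+chain≤adjacent : ∀ a b →
    ⟦ touches a b ⟧ + (⟦ isPredecessor a b ⟧ + ⟦ isSuccessor a b ⟧) ≤ ⟦ adjᵇ (p a) (p b) ⟧
  touches+chain≤adjacent a b = begin
    ⟦ t ⟧ + (⟦ P ⟧ + ⟦ S ⟧)  ≡⟨ cong (⟦ t ⟧ +_) (⟦⟧-∨ {P} not-both-neighbours) ⟩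
    ⟦ t ⟧ + ⟦ P ∨ S ⟧        ≡⟨ ⟦⟧-∨ {t} touches-not-neighbour ⟩
    ⟦ t ∨ (P ∨ S) ⟧          ≤⟨ ⟦⟧-mono {t ∨ (P ∨ S)} adjacent ⟩
    ⟦ adjᵇ (p a) (p b) ⟧     ∎
    where
    open ≤-Reasoning
    t = touches a b
    P = isPredecessor a b
    S = isSuccessor a b
    chain : T (P ∨ S) → suc (toℕ b) ≡ toℕ a ⊎ toℕ b ≡ suc (toℕ a)
    chain ps with to (T-∨ {P}) ps
    ... | inj₁ pred = inj₁ (≡ᵇ⇒≡ _ _ pred)
    ... | inj₂ succ = inj₂ (≡ᵇ⇒≡ _ _ succ)
    not-both-neighbours : T P → T S → ⊥
    not-both-neighbours pred succ = 1+n≰n (begin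
      suc (toℕ a)  ≡⟨ ≡ᵇ⇒≡ _ _ succ ⟨
      toℕ b        ≤⟨ n≤1+n _ ⟩
      suc (toℕ b)  ≡⟨ ≡ᵇ⇒≡ _ _ pred ⟩
      toℕ a        ∎)
    touches-not-neighbour : T t → T (P ∨ S) → ⊥
    touches-not-neighbour t′ ps = consecutive-not-far (chain ps) (proj₂ (proj₂ (touches⇒ a b t′)))
    adjacent : T (t ∨ (P ∨ S)) → Adjacent (p a) (p b)
    adjacent x with to (T-∨ {t}) x
    ... | inj₁ t′ = proj₁ (proj₂ (touches⇒ a b t′))
    ... | inj₂ ps with chain ps
    ...   | inj₁ b+1≡a = adjacent-sym (p b) (p a) (walk f b a b+1≡a)
    ...   | inj₂ b≡a+1 = walk f a b (sym b≡a+1)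

  polar⇒count-touches≡0 : ∀ a → ¬ T (isZero (letter w a)) → count (touches a) ≡ 0
  polar⇒count-touches≡0 a polar = count-none (touches a) (λ b → polar ∘ proj₁ ∘ touches⇒ a b)

  -- The three lattice neighbours of the site of a are shared between the residues touching a and
  -- the chain neighbours of a, of which there are two unless a is an end of the chain.
  count-touches≤ : ∀ a → count (touches a) ≤ 1 + (⟦ toℕ a ≡ᵇ 0 ⟧ + ⟦ toℕ a ≡ᵇ pred n ⟧)
  count-touches≤ a = +-cancelˡ-≤ 2 t (1 + (first + last)) (begin
    2 + t                                               ≡⟨ +-comm 2 t ⟩
    t + 2                                               ≡⟨ cong₂ (λ x y → t + (x + y))
                                                              (count-predecessors n (toℕ a) (toℕ<n a))
                                                              (count-successors n (toℕ a) (toℕ<n a)) ⟨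
    t + ((predecessors + first) + (successors + last))  ≡⟨ regroup t predecessors successors first last ⟩
    (t + (predecessors + successors)) + (first + last)  ≤⟨ +-monoˡ-≤ (first + last) at-most-3 ⟩
    3 + (first + last)                                  ∎)
    where
    open ≤-Reasoning
    t = count (touches a)
    predecessors = count (isPredecessor a)
    successors = count (isSuccessor a)
    first = ⟦ toℕ a ≡ᵇ 0 ⟧
    last = ⟦ toℕ a ≡ᵇ pred n ⟧
    P S : Fin n → ℕ
    P b = ⟦ isPredecessor a b ⟧
    S b = ⟦ isSuccessor a b ⟧
    regroup : ∀ t p s e e′ → t + ((p + e) + (s + e′)) ≡ (t + (p + s)) + (e + e′)
    regroup = ℕ-Solver.solve-∀
    at-most-3 : t + (predecessors + successors) ≤ 3
    at-most-3 = begin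
      t + (predecessors + successors)             ≡⟨ cong (t +_) (∑-distrib-+ P S) ⟨
      t + ∑[ b < n ] (P b + S b)                  ≡⟨ ∑-distrib-+ (λ b → ⟦ touches a b ⟧) (λ b → P b + S b) ⟨
      ∑[ b < n ] (⟦ touches a b ⟧ + (P b + S b))  ≤⟨ ∑-mono-≤ (touches+chain≤adjacent a) ⟩
      count (λ b → adjᵇ (p a) (p b))              ≤⟨ neighbours≤3 p (selfAvoiding f) (p a) ⟩
      3                                           ∎

  2*score≤Z+2 : 2 * score w f ≤ Z w + 2
  2*score≤Z+2 = begin
    2 * score w f                                            ≡⟨ ∑-count-touches≡2*score ⟨
    ∑[ a < n ] count (touches a)                             ≤⟨ ∑-mono-≤ (λ a → ≤-⟦⟧+ (isZero (letter w a))
                                                                  (polar⇒count-touches≡0 a) (count-touches≤ a)) ⟩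
    ∑[ a < n ] (hydrophobic a + (first a + last a))          ≡⟨ ∑-distrib-+ hydrophobic (λ a → first a + last a) ⟩
    ∑[ a < n ] hydrophobic a + ∑[ a < n ] (first a + last a) ≡⟨ cong₂ _+_ (count-zeros w) (∑-distrib-+ first last) ⟩
    Z w + (∑[ a < n ] first a + ∑[ a < n ] last a)           ≡⟨ cong (Z w +_) (cong₂ _+_ (count-≡ᵇ n 0)
                                                                                       (count-≡ᵇ n (pred n))) ⟩
    Z w + (⟦ 0 <ᵇ n ⟧ + ⟦ pred n <ᵇ n ⟧)                    ≤⟨ +-monoʳ-≤ (Z w) (+-mono-≤ (⟦⟧≤1 (0 <ᵇ n))
                                                                                        (⟦⟧≤1 (pred n <ᵇ n))) ⟩
    Z w + 2                                                  ∎
    where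
    open ≤-Reasoning
    hydrophobic first last : Fin n → ℕ
    hydrophobic a = ⟦ isZero (letter w a) ⟧
    first a = ⟦ toℕ a ≡ᵇ 0 ⟧
    last a = ⟦ toℕ a ≡ᵇ pred n ⟧

-- The hairpin fold of w_k

contactℕ : Word → (ℕ → Vertex) → ℕ → ℕ → Bool
contactℕ w g m m′ = (suc (suc m) ≤ᵇ m′) ∧ isZero (letterAt w m) ∧ isZero (letterAt w m′) ∧ adjᵇ (g m) (g m′)

contactℕ-intro : ∀ w g {m m′} → 2 + m ≤ m′ → letterAt w m ≡ b0 → letterAt w m′ ≡ b0 →
                 Adjacent (g m) (g m′) → T (contactℕ w g m m′)
contactℕ-intro w g {m} {m′} far hydrophobic hydrophobic′ adj rewrite hydrophobic | hydrophobic′ =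
  from (T-∧ {suc (suc m) ≤ᵇ m′}) (≤⇒≤ᵇ far , adj)

module _ (w : Word) (g : ℕ → Vertex)
         (injective : ∀ {m m′} → m < length w → m′ < length w → g m ≡ g m′ → m ≡ m′)
         (steps : ∀ {m} → suc m < length w → Adjacent (g m) (g (suc m))) where
  private
    n = length w

  foldAlong : Fold w
  foldAlong = record
    { pos          = g ∘ toℕ
    ; selfAvoiding = λ {i} {j} → toℕ-injective ∘ injective (toℕ<n i) (toℕ<n j)
    ; walk         = λ i j i+1≡j → subst (λ m → Adjacent (g (toℕ i)) (g m)) i+1≡j
                                     (steps (subst (_< length w) (sym i+1≡j) (toℕ<n j)))
    }

  score-foldAlong : score w foldAlong ≡ sumBelow n (λ m → sumBelow n (λ m′ → ⟦ contactℕ w g m m′ ⟧))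
  score-foldAlong = begin
    score w foldAlong                                            ≡⟨ score≡∑∑ foldAlong ⟩
    ∑[ i < n ] ∑[ j < n ] ⟦ contactᵇ w foldAlong (i , j) ⟧       ≡⟨ sum-cong-≗ (λ i → sum-cong-≗ (λ j →
                                                                      cong ⟦_⟧ (by-letterAt i j))) ⟩
    ∑[ i < n ] ∑[ j < n ] ⟦ contactℕ w g (toℕ i) (toℕ j) ⟧       ≡⟨ sum-cong-≗ {n} (λ i → ∑-toℕ n (row (toℕ i))) ⟩
    ∑[ i < n ] sumBelow n (row (toℕ i))                          ≡⟨ ∑-toℕ n (λ m → sumBelow n (row m)) ⟩
    sumBelow n (λ m → sumBelow n (row m))                        ∎
    where
    open ≡-Reasoning
    row : ℕ → ℕ → ℕ
    row m m′ = ⟦ contactℕ w g m m′ ⟧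
    by-letterAt : ∀ i j → contactᵇ w foldAlong (i , j) ≡ contactℕ w g (toℕ i) (toℕ j)
    by-letterAt i j = cong₂ (λ a b → (suc (suc (toℕ i)) ≤ᵇ toℕ j) ∧ isZero a ∧ isZero b
                                       ∧ adjᵇ (g (toℕ i)) (g (toℕ j)))
                            (letter≡letterAt w i) (letter≡letterAt w j)

-- Residues 0–7 (the prefix 0 1^4 0 1 1) go round the hexagon left of the origin; residue 8 + m lies
-- at (m, 0) for m ≤ width and at (lastOffset ∸ m, 1) beyond. The hydrophobic residue 8 + 2t, at
-- (2t, 0), then faces the one at (2t, 1), which is `rung s` for t + s + 1 = k; residue 0, at
-- (−1, 1), touches residue 5 at (−2, 1) and the last residue at (0, 1).
module Hairpin (k : ℕ) where

  width lastOffset : ℕ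
  width      = k * 2
  lastOffset = suc (width + width)

  position : ℕ → Vertex
  position 0 = ℤ.-[1+ 0 ] , ℤ.+ 1
  position 1 = ℤ.-[1+ 0 ] , ℤ.+ 2
  position 2 = ℤ.-[1+ 1 ] , ℤ.+ 2
  position 3 = ℤ.-[1+ 2 ] , ℤ.+ 2
  position 4 = ℤ.-[1+ 2 ] , ℤ.+ 1
  position 5 = ℤ.-[1+ 1 ] , ℤ.+ 1
  position 6 = ℤ.-[1+ 1 ] , ℤ.+ 0
  position 7 = ℤ.-[1+ 0 ] , ℤ.+ 0
  position (suc (suc (suc (suc (suc (suc (suc (suc m)))))))) =
    if m ≤ᵇ width then (ℤ.+ m , ℤ.+ 0) else (ℤ.+ (lastOffset ∸ m) , ℤ.+ 1)

  index : Vertex → ℕ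
  index (ℤ.-[1+ 0 ] , ℤ.+ 1) = 0
  index (ℤ.-[1+ 0 ] , ℤ.+ 2) = 1
  index (ℤ.-[1+ 1 ] , ℤ.+ 2) = 2
  index (ℤ.-[1+ 2 ] , ℤ.+ 2) = 3
  index (ℤ.-[1+ 2 ] , ℤ.+ 1) = 4
  index (ℤ.-[1+ 1 ] , ℤ.+ 1) = 5
  index (ℤ.-[1+ 1 ] , ℤ.+ 0) = 6
  index (ℤ.-[1+ 0 ] , ℤ.+ 0) = 7
  index (ℤ.+ x      , ℤ.+ 0) = 8 + x
  index (ℤ.+ x      , ℤ.+ 1) = 8 + (lastOffset ∸ x)
  index _                    = 0

  length-wk : length (wk k) ≡ 8 + (width + (2 + width))
  length-wk = cong (8 +_) (trans (length-++ (pow k (b0 ∷ b1 ∷ [])))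
                                 (cong₂ (λ a b → a + (2 + b)) (length-pow k _) (length-pow k _)))

  position-row₀ : ∀ {m} → m ≤ width → position (8 + m) ≡ (ℤ.+ m , ℤ.+ 0)
  position-row₀ m≤width rewrite to T-≡ (≤⇒≤ᵇ m≤width) = refl

  position-row₁ : ∀ {m} → width < m → position (8 + m) ≡ (ℤ.+ (lastOffset ∸ m) , ℤ.+ 1)
  position-row₁ {m} width<m with m ≤ᵇ width in m≤ᵇwidth
  ... | false = refl
  ... | true  = contradiction (≤ᵇ⇒≤ m width (from T-≡ m≤ᵇwidth)) (<⇒≱ width<m)

  offset≤lastOffset : ∀ {m} → 8 + m < length (wk k) → m ≤ lastOffset
  offset≤lastOffset {m} 8+m<length = s≤s⁻¹ (begin-strict
    m                        <⟨ +-cancelˡ-< 8 m _ (subst (8 + m <_) length-wk 8+m<length) ⟩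
    width + (2 + width)      ≡⟨ +-suc width (suc width) ⟩
    suc (width + suc width)  ≡⟨ cong suc (+-suc width width) ⟩
    suc lastOffset           ∎)
    where open ≤-Reasoning

  index-position : ∀ m → m < length (wk k) → index (position m) ≡ m
  index-position 0 _ = refl
  index-position 1 _ = refl
  index-position 2 _ = refl
  index-position 3 _ = refl
  index-position 4 _ = refl
  index-position 5 _ = refl
  index-position 6 _ = refl
  index-position 7 _ = refl
  index-position (suc (suc (suc (suc (suc (suc (suc (suc m)))))))) 8+m<length with m ≤? width
  ... | yes m≤width rewrite position-row₀ m≤width = refl
  ... | no  m≰width rewrite position-row₁ (≰⇒> m≰width) =
    cong (8 +_) (m∸[m∸n]≡n (offset≤lastOffset 8+m<length))

  position-injective : ∀ {m m′} → m < length (wk k) → m′ < length (wk k) →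
                       position m ≡ position m′ → m ≡ m′
  position-injective {m} {m′} m<length m′<length same = begin
    m                    ≡⟨ index-position m m<length ⟨
    index (position m)   ≡⟨ cong index same ⟩
    index (position m′)  ≡⟨ index-position m′ m′<length ⟩
    m′                   ∎
    where open ≡-Reasoning

  steps : ∀ {m} → suc m < length (wk k) → Adjacent (position m) (position (suc m))
  steps {0} _ = tt
  steps {1} _ = tt
  steps {2} _ = tt
  steps {3} _ = tt
  steps {4} _ = tt
  steps {5} _ = tt
  steps {6} _ = tt
  steps {7} _ = tt
  steps {suc (suc (suc (suc (suc (suc (suc (suc m)))))))} 9+m<length with <-cmp m width
  ... | tri< m<width _ _ = edge⇒adjacent
    (subst₂ Edge (sym (position-row₀ (<⇒≤ m<width))) (sym (position-row₀ m<width))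
      (subst (λ x → Edge (ℤ.+ m , ℤ.+ 0) (x , ℤ.+ 0)) (cong ℤ.+_ (+-comm m 1)) right))
  ... | tri≈ _ refl _ = edge⇒adjacent
    (subst₂ Edge (sym (position-row₀ ≤-refl)) (sym (trans (position-row₁ ≤-refl) turn))
      (up (evenℤ-*2+0 k)))
    where
    turn : (ℤ.+ (lastOffset ∸ suc width) , ℤ.+ 1) ≡ (ℤ.+ width , ℤ.+ 1)
    turn = cong (λ x → ℤ.+ x , ℤ.+ 1) (m+n∸m≡n width width)
  ... | tri> _ _ width<m = edge⇒adjacent
    (subst₂ Edge (sym (trans (position-row₁ width<m) back)) (sym (position-row₁ (<-trans width<m (n<1+n m))))
      left)
    where
    back : (ℤ.+ (lastOffset ∸ m) , ℤ.+ 1) ≡ (ℤ.+ suc (lastOffset ∸ suc m) , ℤ.+ 1)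
    back = cong (λ x → ℤ.+ x , ℤ.+ 1) (+-∸-assoc 1 (offset≤lastOffset 9+m<length))

  fold : Fold (wk k)
  fold = foldAlong (wk k) position position-injective steps

  contact : ℕ → ℕ → Bool
  contact = contactℕ (wk k) position

  rung : ℕ → ℕ
  rung s = 8 + (width + (3 + s * 2))

  rung<length : ∀ {s} → s < k → rung s < length (wk k)
  rung<length {s} s<k = subst (rung s <_) (sym length-wk)
    (+-monoʳ-< 8 (+-monoʳ-< width (s≤s (s≤s (*-monoˡ-≤ 2 s<k)))))

  letterAt-row₀ : ∀ {t} → t < k → letterAt (wk k) (8 + t * 2) ≡ b0
  letterAt-row₀ {t} t<k = trans
    (letterAt-++ˡ (pow k (b0 ∷ b1 ∷ [])) (subst (t * 2 <_) (sym (length-pow k _)) (*-monoˡ-< 2 t<k)))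
    (letterAt-pow-even b0 b1 t<k)

  letterAt-rung : ∀ {s} → s < k → letterAt (wk k) (rung s) ≡ b0
  letterAt-rung {s} s<k = begin
    letterAt (arm₀ ++ rest) (width + (3 + s * 2))        ≡⟨ cong (λ l → letterAt (arm₀ ++ rest) (l + (3 + s * 2)))
                                                                (length-pow k (b0 ∷ b1 ∷ [])) ⟨
    letterAt (arm₀ ++ rest) (length arm₀ + (3 + s * 2))  ≡⟨ letterAt-++ʳ arm₀ (3 + s * 2) ⟩
    letterAt (pow k (b1 ∷ b0 ∷ [])) (suc (s * 2))        ≡⟨ letterAt-pow-odd b1 b0 s<k ⟩
    b0                                                   ∎
    where
    open ≡-Reasoning
    arm₀ = pow k (b0 ∷ b1 ∷ [])
    rest = b1 ∷ b1 ∷ pow k (b1 ∷ b0 ∷ [])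

  position-rung : ∀ {t s} → suc (t + s) ≡ k → position (rung s) ≡ (ℤ.+ (t * 2) , ℤ.+ 1)
  position-rung {t} {s} refl = trans (position-row₁ (m<m+n width (s≤s z≤n)))
    (cong (λ x → ℤ.+ x , ℤ.+ 1) (begin
      lastOffset ∸ (width + (3 + s * 2))                ≡⟨ cong (_∸ (width + (3 + s * 2))) (regroup t s) ⟩
      (width + (3 + s * 2)) + t * 2 ∸ (width + (3 + s * 2)) ≡⟨ m+n∸m≡n (width + (3 + s * 2)) (t * 2) ⟩
      t * 2                                             ∎))
    where
    open ≡-Reasoning
    regroup : ∀ t s → suc (suc (t + s) * 2 + suc (t + s) * 2) ≡ (suc (t + s) * 2 + (3 + s * 2)) + t * 2
    regroup = ℕ-Solver.solve-∀

  rung-contact : ∀ {t s} → suc (t + s) ≡ k → T (contact (8 + t * 2) (rung s))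
  rung-contact {t} {s} t+s+1≡k =
    contactℕ-intro (wk k) position far (letterAt-row₀ t<k) (letterAt-rung s<k) (edge⇒adjacent
      (subst₂ Edge (sym (position-row₀ (*-monoˡ-≤ 2 (<⇒≤ t<k)))) (sym (position-rung {t} {s} t+s+1≡k))
                   (up (evenℤ-*2+0 t))))
    where
    t<k : t < k
    t<k = subst (t <_) t+s+1≡k (s≤s (m≤m+n t s))
    s<k : s < k
    s<k = subst (s <_) t+s+1≡k (s≤s (m≤n+m s t))
    far : 2 + (8 + t * 2) ≤ rung s
    far = +-monoʳ-≤ 8 (begin
      2 + t * 2            ≤⟨ +-monoʳ-≤ 2 (*-monoˡ-≤ 2 (<⇒≤ t<k)) ⟩
      2 + width            ≡⟨ +-comm 2 width ⟩
      width + 2            ≤⟨ +-monoʳ-≤ width (m≤m+n 2 (suc (s * 2))) ⟩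
      width + (3 + s * 2)  ∎)
      where open ≤-Reasoning

  row : ℕ → ℕ
  row m = sumBelow (length (wk k)) (λ m′ → ⟦ contact m m′ ⟧)

  2≤row₀ : 1 ≤ k → 2 ≤ row 0
  2≤row₀ (s≤s {n = k′} _) = begin
    2                                            ≡⟨ cong₂ _+_ (⟦⟧-true closes-hexagon) (⟦⟧-true closes-hairpin) ⟨
    ⟦ contact 0 5 ⟧ + ⟦ contact 0 (rung k′) ⟧    ≤⟨ two-terms≤sumBelow (λ m′ → ⟦ contact 0 m′ ⟧)
                                                      (s≤s (s≤s (s≤s (s≤s (s≤s (s≤s z≤n))))))
                                                      (rung<length (n<1+n k′)) ⟩
    row 0                                        ∎
    where
    open ≤-Reasoning
    closes-hexagon : T (contact 0 5)
    closes-hexagon = tt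
    closes-hairpin : T (contact 0 (rung k′))
    closes-hairpin = contactℕ-intro (wk k) position {0} {rung k′} (s≤s (s≤s z≤n)) refl
      (letterAt-rung (n<1+n k′)) (subst (Adjacent (position 0)) (sym (position-rung {0} {k′} refl)) tt)

  1≤row₀-rung : ∀ {t} → t < k → 1 ≤ row (8 + t * 2)
  1≤row₀-rung {t} t<k with m≤n⇒∃[o]m+o≡n t<k
  ... | s , t+s+1≡k = begin
    1                                 ≡⟨ ⟦⟧-true (rung-contact {t} {s} t+s+1≡k) ⟨
    ⟦ contact (8 + t * 2) (rung s) ⟧  ≤⟨ term≤sumBelow (λ m′ → ⟦ contact (8 + t * 2) m′ ⟧)
                                           (rung<length (subst (s <_) t+s+1≡k (s≤s (m≤n+m s t)))) ⟩
    row (8 + t * 2)                   ∎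
    where open ≤-Reasoning

  2+k≤score : 1 ≤ k → 2 + k ≤ score (wk k) fold
  2+k≤score 1≤k = begin
    2 + k                                        ≤⟨ +-mono-≤ (2≤row₀ 1≤k) rows ⟩
    row 0 + sumBelow (7 + arms) (row ∘ suc)      ≡⟨ cong (λ n → sumBelow n row) length-wk ⟨
    sumBelow (length (wk k)) row                 ≡⟨ score-foldAlong (wk k) position position-injective steps ⟨
    score (wk k) fold                            ∎
    where
    open ≤-Reasoning
    arms : ℕ
    arms = width + (2 + width)
    after : ℕ → ℕ
    after j = row (8 + j)
    rows : k ≤ sumBelow (7 + arms) (row ∘ suc)
    rows = begin
      k                                                  ≤⟨ k≤sumBelow k (λ t → after (t * 2)) (λ t → 1≤row₀-rung) ⟩
      sumBelow k (λ t → after (t * 2))                   ≤⟨ sumBelow-*2≤ k after ⟩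
      sumBelow width after                               ≤⟨ m≤m+n _ _ ⟩
      sumBelow width after + sumBelow (2 + width) (λ j → after (width + j))
                                                         ≡⟨ sumBelow-+ width (2 + width) after ⟨
      sumBelow arms after                                ≤⟨ m≤n+m _ _ ⟩
      sumBelow 7 (row ∘ suc) + sumBelow arms after       ≡⟨ sumBelow-+ 7 arms (row ∘ suc) ⟨
      sumBelow (7 + arms) (row ∘ suc)                    ∎

Z-wk : ∀ k → Z (wk k) ≡ (1 + k) * 2
Z-wk k = begin
  2 + Z (pow k (b0 ∷ b1 ∷ []) ++ b1 ∷ b1 ∷ pow k (b1 ∷ b0 ∷ []))  ≡⟨ cong (2 +_) (Z-++ (pow k (b0 ∷ b1 ∷ [])) _) ⟩
  2 + (Z (pow k (b0 ∷ b1 ∷ [])) + Z (pow k (b1 ∷ b0 ∷ [])))       ≡⟨ cong₂ (λ a b → 2 + (a + b)) (Z-pow k _)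
                                                                                                (Z-pow k _) ⟩
  2 + (k * 1 + k * 1)                                              ≡⟨ regroup k ⟩
  (1 + k) * 2                                                      ∎
  where
  open ≡-Reasoning
  regroup : ∀ k → 2 + (k * 1 + k * 1) ≡ (1 + k) * 2
  regroup = ℕ-Solver.solve-∀

Z-wk/2+1 : ∀ k → Z (wk k) / 2 + 1 ≡ 2 + k
Z-wk/2+1 k = begin
  Z (wk k) / 2 + 1     ≡⟨ cong (λ z → z / 2 + 1) (Z-wk k) ⟩
  (1 + k) * 2 / 2 + 1  ≡⟨ cong (_+ 1) (m*n/n≡m (1 + k) 2) ⟩
  1 + k + 1            ≡⟨ +-comm (1 + k) 1 ⟩
  2 + k                ∎
  where open ≡-Reasoning

Z-wk+2 : ∀ k → Z (wk k) + 2 ≡ 2 * (2 + k)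
Z-wk+2 k = trans (cong (_+ 2) (Z-wk k)) (regroup k)
  where
  regroup : ∀ k → (1 + k) * 2 + 2 ≡ 2 * (2 + k)
  regroup = ℕ-Solver.solve-∀

theorem2p9 : ∀ (k : ℕ) → 1 ≤ k → JhexIs (wk k) (Z (wk k) / 2 + 1)
theorem2p9 k 1≤k rewrite Z-wk/2+1 k = (fold , ≤-antisym (optimal fold) (2+k≤score 1≤k)) , optimal
  where
  open Hairpin k
  optimal : ∀ f → score (wk k) f ≤ 2 + k
  optimal f = *-cancelˡ-≤ 2 (≤-trans (2*score≤Z+2 f) (≤-reflexive (Z-wk+2 k)))
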